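{- Let $n \ge 5$ and let $X = \mathrm{Cay}(S_n,S)$ be the complete transposition graph, where $S$ is the set of all transpositions in $S_n$. For $r \ge 0$ let $X_r(e)$ denote the set of vertices of $X$ at distance exactly $r$ from the identity vertex $e$. Let $k \ge 3$ and let $\alpha, \beta$ be distinct vertices in $X_k(e)$. Then the set of neighbors of $\alpha$ in $X_{k-1}(e)$ is not equal to the set of neighbors of $\beta$ in $X_{k-1}(e)$.
   Context: For a group $H$ and a subset $S \subseteq H$ with $1 \notin S$ and $S = S^{ -1}$, the Cayley graph $\mathrm{Cay}(H,S)$ is the simple undirected graph with vertex set $H$ and edges $\{h, sh\}$ for $h \in H$, $s \in S$. -}

module Defs where

open import Data.Nat using (ℕ; zero; suc; _<_)
open import Data.Fin using (Fin)
open import Data.Fin.Permutation using (Permutation′; id; transpose; _∘ₚ_; _≈_)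
open import Data.Product using (Σ; ∃; _×_; _,_)
open import Relation.Binary.PropositionalEquality using (_≢_)
open import Relation.Nullary using (¬_)

IsTransposition : {n : ℕ} → Permutation′ n → Set
IsTransposition {n} s = Σ (Fin n) λ i → Σ (Fin n) λ j → (i ≢ j) × (s ≈ transpose i j)

-- Edge relation of Cay(S_n, S): {h, s h} for s ∈ S.
-- Note: π₁ ∘ₚ π₂ applies π₁ first, so the group product  s h  (apply h, then s)
-- is  h ∘ₚ s.
Adj : {n : ℕ} → Permutation′ n → Permutation′ n → Set
Adj {n} h g = Σ (Permutation′ n) λ s → IsTransposition s × (g ≈ (h ∘ₚ s))

Walk : {n : ℕ} → ℕ → Permutation′ n → Set
Walk {n} zero α = α ≈ id
Walk {n} (suc r) α = Σ (Permutation′ n) λ β → Walk r β × Adj β α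

InSphere : {n : ℕ} → ℕ → Permutation′ n → Set
InSphere r α = Walk r α × (∀ m → m < r → ¬ Walk m α)

NbrIn : {n : ℕ} → ℕ → Permutation′ n → Permutation′ n → Set
NbrIn r α γ = Adj α γ × InSphere r γ

-- Take a geodesic e, …, p, p w, p w x, α = p w x y from e to α, where w, x, y are
-- transpositions and products are read left to right, as _∘ₚ_ composes. The transpositions
-- u₂ = y x y and u₁ = y x w x y lead from α to p w y and p x y, which lie in X_{k-1}. If β
-- has the same neighbours in X_{k-1}, it is a neighbour of p w x, so β = α y z with z ≠ y,
-- and u₁, u₂ both occur as first factors u v of y z. Such a factor moves only points moved
-- by y or z, at most four of them, so a finite computation on Fin 3 or Fin 4 shows that
-- y u₂ u₁ is a transposition. Then α = p (y u₂ u₁) is at distance at most k − 2 from e.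
module Submission where

open import Defs
open import Data.Empty using (⊥-elim)
open import Data.Fin using (Fin)
open import Data.Fin.Patterns using (0F; 1F; 2F; 3F)
open import Data.Fin.Properties using (_≟_; any?; all?)
open import Data.Fin.Permutation
  using (Permutation′; _≈_; id; transpose; _∘ₚ_; _⟨$⟩ʳ_; _⟨$⟩ˡ_; inverseˡ; inverseʳ)
open import Data.Fin.Permutation.Components using (transpose-inverse) renaming (transpose to swap)
open import Data.Nat using (ℕ; suc; _≤_; _∸_; s≤s)
open import Data.Nat.Properties using (n≤1+n)
open import Data.Product using (Σ; ∃; _×_; _,_; proj₁; proj₂)
open import Data.Vec using ([]; _∷_; lookup)
open import Data.Vec.Relation.Unary.All using ([]; _∷_)
open import Data.Vec.Relation.Unary.AllPairs using ([]; _∷_)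
open import Data.Vec.Relation.Unary.Unique.Propositional using (Unique)
open import Data.Vec.Relation.Unary.Unique.Propositional.Properties using (lookup-injective)
open import Function using (_∘_)
open import Function.Bundles using (_⇔_; Equivalence)
open import Function.Definitions using (Injective)
open import Level using (0ℓ)
open import Relation.Binary.Bundles using (Setoid)
import Relation.Binary.Reasoning.Setoid as SetoidReasoning
open import Relation.Binary.PropositionalEquality
open import Relation.Nullary using (¬_; Dec; yes; no)
open import Relation.Nullary.Decidable using (_→-dec_; _×-dec_; ¬?; toWitness; dec-true; dec-false)

private
  variable
    m n : ℕ

IsSwap : (Fin m → Fin m) → Set
IsSwap {m} f = Σ (Fin m) λ i → Σ (Fin m) λ j → i ≢ j × (∀ t → f t ≡ swap i j t)

isSwap? : (f : Fin m → Fin m) → Dec (IsSwap f)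
isSwap? f = any? λ i → any? λ j → ¬? (i ≟ j) ×-dec all? λ t → f t ≟ swap i j t

data Position (i j : Fin n) : Fin n → Set where
  left  : Position i j i
  right : Position i j j
  other : ∀ {k} → k ≢ i → k ≢ j → Position i j k

position : (i j k : Fin n) → Position i j k
position i j k with k ≟ i | k ≟ j
... | yes refl | _        = left
... | no _     | yes refl = right
... | no k≢i   | no k≢j   = other k≢i k≢j

swap-left : (i j : Fin n) → swap i j i ≡ j
swap-left i j rewrite dec-true (i ≟ i) refl = refl

swap-right : (i j : Fin n) → swap i j j ≡ i
swap-right i j with j ≟ i
... | yes j≡i = j≡i
... | no _ rewrite dec-true (j ≟ j) refl = refl

swap-other : {i j k : Fin n} → k ≢ i → k ≢ j → swap i j k ≡ k
swap-other {i = i} {j} {k} k≢i k≢j rewrite dec-false (k ≟ i) k≢i | dec-false (k ≟ j) k≢j = refl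

swap-sym : (i j k : Fin n) → swap i j k ≡ swap j i k
swap-sym i j k with position i j k
... | left          = trans (swap-left i j) (sym (swap-right j i))
... | right         = trans (swap-right i j) (sym (swap-left j i))
... | other k≢i k≢j = trans (swap-other k≢i k≢j) (sym (swap-other k≢j k≢i))

swap-involutive : (i j k : Fin n) → swap i j (swap i j k) ≡ k
swap-involutive i j k = trans (cong (swap i j) (swap-sym i j k)) (transpose-inverse i j)

swap-determined : {g h e f : Fin n} → swap g h e ≡ f → e ≢ f → ∀ t → swap g h t ≡ swap e f t
swap-determined {g = g} {h} {e} {f} eq e≢f t with position g h e
... | left          = cong (λ r → swap e r t) (trans (sym (swap-left e h)) eq)
... | right         = trans (cong (λ r → swap r e t) (trans (sym (swap-right g e)) eq)) (swap-sym f e t)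
... | other e≢g e≢h = ⊥-elim (e≢f (trans (sym (swap-other e≢g e≢h)) eq))

swap-natural : (f : Fin m → Fin n) → Injective _≡_ _≡_ f →
               (i j t : Fin m) → f (swap i j t) ≡ swap (f i) (f j) (f t)
swap-natural f f-inj i j t with position i j t
... | left          = trans (cong f (swap-left i j)) (sym (swap-left (f i) (f j)))
... | right         = trans (cong f (swap-right i j)) (sym (swap-right (f i) (f j)))
... | other t≢i t≢j = trans (cong f (swap-other t≢i t≢j)) (sym (swap-other (t≢i ∘ f-inj) (t≢j ∘ f-inj)))

private
  variable
    r : ℕ
    α β δ p q u v w x y z : Permutation′ n

⟨$⟩ʳ-injective : (π : Permutation′ n) → Injective _≡_ _≡_ (π ⟨$⟩ʳ_)
⟨$⟩ʳ-injective π eq = trans (sym (inverseˡ π)) (trans (cong (π ⟨$⟩ˡ_) eq) (inverseˡ π))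

∘ₚ-cancelˡ : (α : Permutation′ n) → α ∘ₚ u ≈ α ∘ₚ v → u ≈ v
∘ₚ-cancelˡ {u = u} {v = v} α eq s =
  subst (λ r → u ⟨$⟩ʳ r ≡ v ⟨$⟩ʳ r) (inverseʳ α) (eq (α ⟨$⟩ˡ s))

transposition-involutive : IsTransposition y → ∀ t → y ⟨$⟩ʳ (y ⟨$⟩ʳ t) ≡ t
transposition-involutive {y = y} (i , j , _ , y≈) t =
  trans (y≈ (y ⟨$⟩ʳ t)) (trans (cong (swap i j) (y≈ t)) (swap-involutive i j t))

isTransposition-conj : IsTransposition y → IsTransposition x → IsTransposition (y ∘ₚ x ∘ₚ y)
isTransposition-conj {y = y} {x = x} ty (i , j , i≢j , x≈) =
  y ⟨$⟩ʳ i , y ⟨$⟩ʳ j , i≢j ∘ ⟨$⟩ʳ-injective y , λ t → begin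
    y ⟨$⟩ʳ (x ⟨$⟩ʳ (y ⟨$⟩ʳ t))
      ≡⟨ cong (y ⟨$⟩ʳ_) (x≈ (y ⟨$⟩ʳ t)) ⟩
    y ⟨$⟩ʳ swap i j (y ⟨$⟩ʳ t)
      ≡⟨ swap-natural (y ⟨$⟩ʳ_) (⟨$⟩ʳ-injective y) i j (y ⟨$⟩ʳ t) ⟩
    swap (y ⟨$⟩ʳ i) (y ⟨$⟩ʳ j) (y ⟨$⟩ʳ (y ⟨$⟩ʳ t))
      ≡⟨ cong (swap (y ⟨$⟩ʳ i) (y ⟨$⟩ʳ j)) (transposition-involutive {y = y} ty t) ⟩
    swap (y ⟨$⟩ʳ i) (y ⟨$⟩ʳ j) t
      ∎
  where open ≡-Reasoning

∘ₚ-≉id : IsTransposition y → ¬ z ≈ y → ¬ y ∘ₚ z ≈ id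
∘ₚ-≉id {y = y} {z = z} ty z≉y yz≈id =
  z≉y λ t → trans (cong (z ⟨$⟩ʳ_) (sym (transposition-involutive {y = y} ty t))) (yz≈id (y ⟨$⟩ʳ t))

Adj-sym : Adj α β → Adj β α
Adj-sym {α = α} (s , ts , β≈) =
  s , ts , λ t → sym (trans (cong (s ⟨$⟩ʳ_) (β≈ t)) (transposition-involutive {y = s} ts (α ⟨$⟩ʳ t)))

record TranspositionFactor (q u : Permutation′ n) : Set where
  constructor factor
  field
    isTransposition          : IsTransposition u
    cofactor                 : Permutation′ n
    cofactor-isTransposition : IsTransposition cofactor
    factorisation            : u ≈ q ∘ₚ cofactor

factor-moves-endpoints : TranspositionFactor q u → ¬ q ≈ id →
                         {e f : Fin n} → e ≢ f → u ≈ transpose e f → q ⟨$⟩ʳ e ≢ e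
factor-moves-endpoints {q = q} {u = u} (factor _ v (g , h , _ , v≈) u≈qv) q≉id {e} {f} e≢f u≈ef qe≡e =
  q≉id λ t → ⟨$⟩ʳ-injective u (trans (sym (v≈u (q ⟨$⟩ʳ t))) (sym (u≈qv t)))
  where
  ve≡f : v ⟨$⟩ʳ e ≡ f
  ve≡f = trans (cong (v ⟨$⟩ʳ_) (sym qe≡e)) (trans (sym (u≈qv e)) (trans (u≈ef e) (swap-left e f)))

  v≈u : ∀ t → v ⟨$⟩ʳ t ≡ u ⟨$⟩ʳ t
  v≈u t = trans (v≈ t) (trans (swap-determined (trans (sym (v≈ e)) ve≡f) e≢f t) (sym (u≈ef t)))

≈-setoid : ℕ → Setoid 0ℓ 0ℓ
≈-setoid n = record
  { Carrier       = Permutation′ n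
  ; _≈_           = _≈_
  ; isEquivalence = record
    { refl  = λ _ → refl
    ; sym   = λ π≈π′ t → sym (π≈π′ t)
    ; trans = λ π≈π′ π′≈π″ t → trans (π≈π′ t) (π′≈π″ t)
    }
  }

∘ₚ-congˡ : (π : Permutation′ n) → u ≈ v → π ∘ₚ u ≈ π ∘ₚ v
∘ₚ-congˡ π u≈v t = u≈v (π ⟨$⟩ʳ t)

∘ₚ-congʳ : (π : Permutation′ n) → u ≈ v → u ∘ₚ π ≈ v ∘ₚ π
∘ₚ-congʳ π u≈v t = cong (π ⟨$⟩ʳ_) (u≈v t)

transposition-cancel : (π y π′ : Permutation′ n) → IsTransposition y → π ∘ₚ y ∘ₚ y ∘ₚ π′ ≈ π ∘ₚ π′
transposition-cancel π y π′ ty t = cong (π′ ⟨$⟩ʳ_) (transposition-involutive {y = y} ty (π ⟨$⟩ʳ t))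

cofactor-≈ : IsTransposition y → IsTransposition z → u ≈ y ∘ₚ z ∘ₚ v → v ≈ z ∘ₚ y ∘ₚ u
cofactor-≈ {y = y} {z = z} {u = u} {v = v} ty tz u≈ = begin
  v                         ≈⟨ transposition-cancel id z v tz ⟨
  z ∘ₚ z ∘ₚ v               ≈⟨ transposition-cancel z y (z ∘ₚ v) ty ⟨
  z ∘ₚ y ∘ₚ y ∘ₚ z ∘ₚ v     ≈⟨ ∘ₚ-congˡ {u = u} {v = y ∘ₚ z ∘ₚ v} (z ∘ₚ y) u≈ ⟨
  z ∘ₚ y ∘ₚ u               ∎
  where open SetoidReasoning (≈-setoid _)

-- The conclusion of transposition-from-factors on Fin m, in the right-to-left order of _∘_:
-- u = swap i j is a factor of y z exactly when its cofactor z y u is a swap.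
FactorProperty : (Y Z : Fin m → Fin m) → Set
FactorProperty Y Z = ∀ i₁ j₁ i₂ j₂ →
  IsSwap (swap i₁ j₁ ∘ Y ∘ Z) → IsSwap (swap i₂ j₂ ∘ Y ∘ Z) → IsSwap (swap i₁ j₁ ∘ swap i₂ j₂ ∘ Y)

factorProperty? : (Y Z : Fin m → Fin m) → Dec (FactorProperty Y Z)
factorProperty? Y Z = all? λ i₁ → all? λ j₁ → all? λ i₂ → all? λ j₂ →
  isSwap? _ →-dec isSwap? _ →-dec isSwap? _

sharing-factorProperty : FactorProperty {3} (swap 0F 1F) (swap 0F 2F)
sharing-factorProperty = toWitness {a? = factorProperty? (swap 0F 1F) (swap 0F 2F)} _

disjoint-factorProperty : FactorProperty {4} (swap 0F 1F) (swap 2F 3F)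
disjoint-factorProperty = toWitness {a? = factorProperty? (swap 0F 1F) (swap 2F 3F)} _

module Support {m n : ℕ} (ρ : Fin m → Fin n) (ρ-injective : Injective _≡_ _≡_ ρ) where

  record Extends (π : Permutation′ n) (σ : Fin m → Fin m) : Set where
    field
      on-image  : ∀ i → π ⟨$⟩ʳ ρ i ≡ ρ (σ i)
      off-image : ∀ x → (∀ i → x ≢ ρ i) → π ⟨$⟩ʳ x ≡ x
  open Extends

  private
    variable
      π π′ : Permutation′ n
      σ σ′ : Fin m → Fin m

  transpose-extends : ∀ i j → Extends (transpose (ρ i) (ρ j)) (swap i j)
  transpose-extends i j = record
    { on-image  = λ t → sym (swap-natural ρ ρ-injective i j t)
    ; off-image = λ x x∉ρ → swap-other (x∉ρ i) (x∉ρ j)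
    }

  extends-resp-≈ : π ≈ π′ → Extends π′ σ → Extends π σ
  extends-resp-≈ π≈π′ e = record
    { on-image  = λ i → trans (π≈π′ (ρ i)) (on-image e i)
    ; off-image = λ x x∉ρ → trans (π≈π′ x) (off-image e x x∉ρ)
    }

  ∘ₚ-extends : Extends π σ → Extends π′ σ′ → Extends (π ∘ₚ π′) (σ′ ∘ σ)
  ∘ₚ-extends {π′ = π′} e e′ = record
    { on-image  = λ i → trans (cong (π′ ⟨$⟩ʳ_) (on-image e i)) (on-image e′ _)
    ; off-image = λ x x∉ρ → trans (cong (π′ ⟨$⟩ʳ_) (off-image e x x∉ρ)) (off-image e′ x x∉ρ)
    }

  extends-unique : Extends π σ → Extends π σ′ → ∀ t → σ t ≡ σ′ t
  extends-unique e e′ t = ρ-injective (trans (sym (on-image e t)) (on-image e′ t))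

  extends-injective : Extends π σ → Extends π′ σ′ → (∀ t → σ t ≡ σ′ t) → π ≈ π′
  extends-injective e e′ σ≗σ′ x with any? (λ i → x ≟ ρ i)
  ... | yes (i , refl) = trans (on-image e i) (trans (cong ρ (σ≗σ′ i)) (sym (on-image e′ i)))
  ... | no x∉ρ = trans (off-image e x (λ i → x∉ρ ∘ (i ,_))) (sym (off-image e′ x (λ i → x∉ρ ∘ (i ,_))))

  moved∈image : Extends π σ → {x : Fin n} → π ⟨$⟩ʳ x ≢ x → ∃ λ i → x ≡ ρ i
  moved∈image e {x} moved with any? (λ i → x ≟ ρ i)
  ... | yes x∈ρ = x∈ρ
  ... | no x∉ρ = ⊥-elim (moved (off-image e x (λ i → x∉ρ ∘ (i ,_))))

  isTransposition⇒isSwap : Extends π σ → IsTransposition π → IsSwap σ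
  isTransposition⇒isSwap {π = π} e (g , h , g≢h , π≈) with
    moved∈image e (λ πg≡g → g≢h (trans (sym πg≡g) (trans (π≈ g) (swap-left g h)))) |
    moved∈image e (λ πh≡h → g≢h (trans (sym (trans (π≈ h) (swap-right g h))) πh≡h))
  ... | i , refl | j , refl =
    i , j , g≢h ∘ cong ρ , extends-unique e (extends-resp-≈ π≈ (transpose-extends i j))

  isSwap⇒isTransposition : Extends π σ → IsSwap σ → IsTransposition π
  isSwap⇒isTransposition e (i , j , i≢j , σ≈) =
    ρ i , ρ j , i≢j ∘ ρ-injective , extends-injective e (transpose-extends i j) σ≈

  factor-extends : Extends q σ → ¬ q ≈ id → TranspositionFactor q u → ∃ λ i → ∃ λ j → Extends u (swap i j)
  factor-extends e q≉id fac@(factor (a , b , a≢b , u≈) _ _ _)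
    with moved∈image e (factor-moves-endpoints fac q≉id a≢b u≈)
       | moved∈image e (factor-moves-endpoints fac q≉id (a≢b ∘ sym) (λ t → trans (u≈ t) (swap-sym a b t)))
  ... | i , refl | j , refl = i , j , extends-resp-≈ u≈ (transpose-extends i j)

  factors-transfer : ∀ {Y Z} → FactorProperty Y Z →
    IsTransposition y → IsTransposition z → Extends y Y → Extends z Z → ¬ y ∘ₚ z ≈ id →
    TranspositionFactor (y ∘ₚ z) u → TranspositionFactor (y ∘ₚ z) v → IsTransposition (y ∘ₚ v ∘ₚ u)
  factors-transfer {y = y} {z = z} {Y = Y} {Z = Z} property ty tz ey ez yz≉id fac-u fac-v
    with factor-extends (∘ₚ-extends ey ez) yz≉id fac-u | factor-extends (∘ₚ-extends ey ez) yz≉id fac-v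
  ... | i₁ , j₁ , eu | i₂ , j₂ , ev =
    isSwap⇒isTransposition (∘ₚ-extends (∘ₚ-extends ey ev) eu)
      (property i₁ j₁ i₂ j₂ (cofactor-isSwap fac-u eu) (cofactor-isSwap fac-v ev))
    where
    cofactor-isSwap : ∀ {w i j} → TranspositionFactor (y ∘ₚ z) w → Extends w (swap i j) →
                      IsSwap (swap i j ∘ Y ∘ Z)
    cofactor-isSwap {w} (factor _ w′ tw′ w≈) ew = isTransposition⇒isSwap {π = w′}
      (extends-resp-≈ (cofactor-≈ {y = y} {z = z} {u = w} {v = w′} ty tz w≈) (∘ₚ-extends (∘ₚ-extends ez ey) ew))
      tw′

data TranspositionPair (y z : Permutation′ n) : Set where
  sharing  : ∀ s a b → Unique (s ∷ a ∷ b ∷ []) →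
             y ≈ transpose s a → z ≈ transpose s b → TranspositionPair y z
  disjoint : ∀ a b c d → Unique (a ∷ b ∷ c ∷ d ∷ []) →
             y ≈ transpose a b → z ≈ transpose c d → TranspositionPair y z

transposition-pair : IsTransposition y → IsTransposition z → ¬ z ≈ y → TranspositionPair y z
transposition-pair (a , b , a≢b , y≈) (c , d , c≢d , z≈) z≉y with position a b c | position a b d
... | left  | left  = ⊥-elim (c≢d refl)
... | left  | right = ⊥-elim (z≉y λ t → trans (z≈ t) (sym (y≈ t)))
... | left  | other d≢a d≢b =
  sharing a b d ((a≢b ∷ c≢d ∷ []) ∷ ((d≢b ∘ sym) ∷ []) ∷ [] ∷ []) y≈ z≈
... | right | left  = ⊥-elim (z≉y λ t → trans (z≈ t) (trans (swap-sym b a t) (sym (y≈ t))))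
... | right | right = ⊥-elim (c≢d refl)
... | right | other d≢a d≢b =
  sharing b a d (((a≢b ∘ sym) ∷ c≢d ∷ []) ∷ ((d≢a ∘ sym) ∷ []) ∷ [] ∷ [])
    (λ t → trans (y≈ t) (swap-sym a b t)) z≈
... | other c≢a c≢b | left =
  sharing a b c ((a≢b ∷ (c≢a ∘ sym) ∷ []) ∷ ((c≢b ∘ sym) ∷ []) ∷ [] ∷ [])
    y≈ (λ t → trans (z≈ t) (swap-sym c a t))
... | other c≢a c≢b | right =
  sharing b a c (((a≢b ∘ sym) ∷ (c≢b ∘ sym) ∷ []) ∷ ((c≢a ∘ sym) ∷ []) ∷ [] ∷ [])
    (λ t → trans (y≈ t) (swap-sym a b t)) (λ t → trans (z≈ t) (swap-sym c b t))
... | other c≢a c≢b | other d≢a d≢b =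
  disjoint a b c d
    ((a≢b ∷ (c≢a ∘ sym) ∷ (d≢a ∘ sym) ∷ []) ∷ ((c≢b ∘ sym) ∷ (d≢b ∘ sym) ∷ []) ∷ (c≢d ∷ []) ∷ [] ∷ [])
    y≈ z≈

transposition-from-factors : IsTransposition y → IsTransposition z → ¬ z ≈ y →
  TranspositionFactor (y ∘ₚ z) u → TranspositionFactor (y ∘ₚ z) v → IsTransposition (y ∘ₚ v ∘ₚ u)
transposition-from-factors {y = y} {z = z} ty tz z≉y fac-u fac-v
  with transposition-pair {y = y} {z = z} ty tz z≉y
... | sharing s a b distinct y≈ z≈ =
  factors-transfer {y = y} {z = z} sharing-factorProperty ty tz
    (extends-resp-≈ y≈ (transpose-extends 0F 1F)) (extends-resp-≈ z≈ (transpose-extends 0F 2F))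
    (∘ₚ-≉id {y = y} {z = z} ty z≉y) fac-u fac-v
  where open Support (lookup (s ∷ a ∷ b ∷ [])) (lookup-injective distinct _ _)
... | disjoint a b c d distinct y≈ z≈ =
  factors-transfer {y = y} {z = z} disjoint-factorProperty ty tz
    (extends-resp-≈ y≈ (transpose-extends 0F 1F)) (extends-resp-≈ z≈ (transpose-extends 2F 3F))
    (∘ₚ-≉id {y = y} {z = z} ty z≉y) fac-u fac-v
  where open Support (lookup (a ∷ b ∷ c ∷ d ∷ [])) (lookup-injective distinct _ _)

module LastSteps {n} (α p w x y : Permutation′ n) (α≈pwxy : α ≈ p ∘ₚ w ∘ₚ x ∘ₚ y) where
  open SetoidReasoning (≈-setoid n)

  delete-x : IsTransposition x → IsTransposition y → α ∘ₚ y ∘ₚ x ∘ₚ y ≈ p ∘ₚ w ∘ₚ y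
  delete-x tx ty = begin
    α ∘ₚ y ∘ₚ x ∘ₚ y                   ≈⟨ ∘ₚ-congʳ {u = α} {v = p ∘ₚ w ∘ₚ x ∘ₚ y} (y ∘ₚ x ∘ₚ y) α≈pwxy ⟩
    p ∘ₚ w ∘ₚ x ∘ₚ y ∘ₚ y ∘ₚ x ∘ₚ y   ≈⟨ transposition-cancel (p ∘ₚ w ∘ₚ x) y (x ∘ₚ y) ty ⟩
    p ∘ₚ w ∘ₚ x ∘ₚ x ∘ₚ y             ≈⟨ transposition-cancel (p ∘ₚ w) x y tx ⟩
    p ∘ₚ w ∘ₚ y                        ∎

  delete-w : IsTransposition w → IsTransposition x → IsTransposition y →
             α ∘ₚ y ∘ₚ x ∘ₚ w ∘ₚ x ∘ₚ y ≈ p ∘ₚ x ∘ₚ y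
  delete-w tw tx ty = begin
    α ∘ₚ y ∘ₚ x ∘ₚ w ∘ₚ x ∘ₚ y                   ≈⟨ ∘ₚ-congʳ {u = α} {v = p ∘ₚ w ∘ₚ x ∘ₚ y} (y ∘ₚ x ∘ₚ w ∘ₚ x ∘ₚ y) α≈pwxy ⟩
    p ∘ₚ w ∘ₚ x ∘ₚ y ∘ₚ y ∘ₚ x ∘ₚ w ∘ₚ x ∘ₚ y   ≈⟨ transposition-cancel (p ∘ₚ w ∘ₚ x) y (x ∘ₚ w ∘ₚ x ∘ₚ y) ty ⟩
    p ∘ₚ w ∘ₚ x ∘ₚ x ∘ₚ w ∘ₚ x ∘ₚ y             ≈⟨ transposition-cancel (p ∘ₚ w) x (w ∘ₚ x ∘ₚ y) tx ⟩
    p ∘ₚ w ∘ₚ w ∘ₚ x ∘ₚ y                       ≈⟨ transposition-cancel p w (x ∘ₚ y) tw ⟩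
    p ∘ₚ x ∘ₚ y                                  ∎

  reassemble : IsTransposition x → IsTransposition y →
               α ≈ p ∘ₚ y ∘ₚ (y ∘ₚ x ∘ₚ y) ∘ₚ (y ∘ₚ x ∘ₚ w ∘ₚ x ∘ₚ y)
  reassemble tx ty = begin
    α                                                  ≈⟨ α≈pwxy ⟩
    p ∘ₚ w ∘ₚ x ∘ₚ y                                  ≈⟨ transposition-cancel p x (w ∘ₚ x ∘ₚ y) tx ⟨
    p ∘ₚ x ∘ₚ x ∘ₚ w ∘ₚ x ∘ₚ y                       ≈⟨ transposition-cancel (p ∘ₚ x) y (x ∘ₚ w ∘ₚ x ∘ₚ y) ty ⟨
    p ∘ₚ x ∘ₚ y ∘ₚ y ∘ₚ x ∘ₚ w ∘ₚ x ∘ₚ y             ≈⟨ transposition-cancel p y (x ∘ₚ y ∘ₚ y ∘ₚ x ∘ₚ w ∘ₚ x ∘ₚ y) ty ⟨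
    p ∘ₚ y ∘ₚ y ∘ₚ x ∘ₚ y ∘ₚ y ∘ₚ x ∘ₚ w ∘ₚ x ∘ₚ y   ∎

sibling : IsTransposition y → IsTransposition z → α ≈ δ ∘ₚ y → δ ≈ β ∘ₚ z → β ≈ α ∘ₚ y ∘ₚ z
sibling {y = y} {z = z} {α = α} {δ = δ} {β = β} ty tz α≈δy δ≈βz t = begin
  β ⟨$⟩ʳ t                              ≡⟨ transposition-involutive {y = z} tz (β ⟨$⟩ʳ t) ⟨
  z ⟨$⟩ʳ (z ⟨$⟩ʳ (β ⟨$⟩ʳ t))            ≡⟨ cong (z ⟨$⟩ʳ_) (δ≈βz t) ⟨
  z ⟨$⟩ʳ (δ ⟨$⟩ʳ t)                     ≡⟨ cong (z ⟨$⟩ʳ_) (transposition-involutive {y = y} ty (δ ⟨$⟩ʳ t)) ⟨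
  z ⟨$⟩ʳ (y ⟨$⟩ʳ (y ⟨$⟩ʳ (δ ⟨$⟩ʳ t)))   ≡⟨ cong (λ s → z ⟨$⟩ʳ (y ⟨$⟩ʳ s)) (α≈δy t) ⟨
  z ⟨$⟩ʳ (y ⟨$⟩ʳ (α ⟨$⟩ʳ t))            ∎
  where open ≡-Reasoning

distinct-siblings : IsTransposition y → ¬ α ≈ β → β ≈ α ∘ₚ y ∘ₚ z → ¬ z ≈ y
distinct-siblings {y = y} {α = α} ty α≉β β≈αyz z≈y =
  α≉β λ t → sym (trans (β≈αyz t) (trans (z≈y _) (transposition-involutive {y = y} ty (α ⟨$⟩ʳ t))))

sphere-neighbour : InSphere (suc r) α → Walk r δ → Adj α δ → NbrIn r α δ
sphere-neighbour {α = α} {δ = δ} (_ , α-minimal) δ-walk α-δ =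
  α-δ , δ-walk , λ j j<r j-walk → α-minimal (suc j) (s≤s j<r) (δ , j-walk , Adj-sym {α = α} {β = δ} α-δ)

SameNeighbours : ℕ → Permutation′ n → Permutation′ n → Set
SameNeighbours {n} r α β = ∀ (γ : Permutation′ n) → NbrIn r α γ ⇔ NbrIn r β γ

shared-neighbour : SameNeighbours r α β → InSphere (suc r) α → Walk r δ → Adj α δ → Adj β δ
shared-neighbour {r = r} {α = α} {δ = δ} same α-sphere δ-walk α-δ =
  proj₁ (Equivalence.to (same δ) (sphere-neighbour {r = r} {α = α} {δ = δ} α-sphere δ-walk α-δ))

shared-neighbour-factor : SameNeighbours r α β → InSphere (suc r) α → β ≈ α ∘ₚ q →
                          IsTransposition u → Walk r (α ∘ₚ u) → TranspositionFactor q u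
shared-neighbour-factor {r = r} {α = α} {β = β} {q = q} {u = u} same α-sphere β≈αq tu walk
  with shared-neighbour {r = r} {α = α} {β = β} {δ = α ∘ₚ u} same α-sphere walk (u , tu , λ _ → refl)
... | v , tv , αu≈βv =
  factor tu v tv (∘ₚ-cancelˡ {u = u} {v = q ∘ₚ v} α λ t → trans (αu≈βv t) (cong (v ⟨$⟩ʳ_) (β≈αq t)))

mainTheorem10 : (n : ℕ) → 5 ≤ n → (k : ℕ) → 3 ≤ k →
    (α β : Permutation′ n) → InSphere k α → InSphere k β → ¬ (α ≈ β) →
    ¬ (∀ (γ : Permutation′ n) → NbrIn (k ∸ 1) α γ ⇔ NbrIn (k ∸ 1) β γ)
mainTheorem10 n _ (suc (suc (suc r))) (s≤s (s≤s (s≤s _))) α β α-sphere _ α≉β same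
  with proj₁ α-sphere
... | γ₀ , γ₀-walk@(γ₁ , (p , p-walk , w , tw , γ₁≈pw) , x , tx , γ₀≈γ₁x) , y , ty , α≈γ₀y
  with shared-neighbour {α = α} {β = β} {δ = γ₀} same α-sphere γ₀-walk
         (Adj-sym {α = γ₀} {β = α} (y , ty , α≈γ₀y))
... | z , tz , γ₀≈βz =
  proj₂ α-sphere (suc r) (s≤s (s≤s (n≤1+n r)))
    (p , p-walk , y ∘ₚ u₂ ∘ₚ u₁ , transposition-from-factors {y = y} {z = z} ty tz z≉y u₁-factor u₂-factor ,
     reassemble tx ty)
  where
  α≈pwxy : α ≈ p ∘ₚ w ∘ₚ x ∘ₚ y
  α≈pwxy t = trans (α≈γ₀y t) (cong (y ⟨$⟩ʳ_) (trans (γ₀≈γ₁x t) (cong (x ⟨$⟩ʳ_) (γ₁≈pw t))))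

  open LastSteps α p w x y α≈pwxy

  β≈αyz : β ≈ α ∘ₚ y ∘ₚ z
  β≈αyz = sibling {y = y} {z = z} {α = α} {δ = γ₀} {β = β} ty tz α≈γ₀y γ₀≈βz

  z≉y : ¬ z ≈ y
  z≉y = distinct-siblings {y = y} {α = α} {β = β} {z = z} ty α≉β β≈αyz

  u₁ u₂ : Permutation′ n
  u₁ = y ∘ₚ x ∘ₚ w ∘ₚ x ∘ₚ y
  u₂ = y ∘ₚ x ∘ₚ y

  neighbour-factor : IsTransposition u → Walk (suc (suc r)) (α ∘ₚ u) → TranspositionFactor (y ∘ₚ z) u
  neighbour-factor {u} = shared-neighbour-factor {α = α} {β = β} {q = y ∘ₚ z} {u = u} same α-sphere β≈αyz

  u₁-factor : TranspositionFactor (y ∘ₚ z) u₁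
  u₁-factor = neighbour-factor
    (isTransposition-conj {y = y} {x = x ∘ₚ w ∘ₚ x} ty (isTransposition-conj {y = x} {x = w} tx tw))
    (p ∘ₚ x , (p , p-walk , x , tx , λ _ → refl) , y , ty , delete-w tw tx ty)

  u₂-factor : TranspositionFactor (y ∘ₚ z) u₂
  u₂-factor = neighbour-factor (isTransposition-conj {y = y} {x = x} ty tx)
    (p ∘ₚ w , (p , p-walk , w , tw , λ _ → refl) , y , ty , delete-x tx ty)
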